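{- Let $G=(V,E)$ be a finite simple undirected graph with vertices $v_1,\dots,v_n$. For $1\le i,j\le n$ let $e_{ij}=i\cdot n^2+j\cdot n$. Let $A_G$ be the quantifier-free symbolic heap of minimal pointer arithmetic $$\bigwedge_{i=1}^{n}(c_0+1\le c_i\ \wedge\ c_i\le c_0+3)\ :\ \mathop{*}_{(v_i,v_j)\in E}\big(c_i+e_{ij}\mapsto\mathsf{nil}\ *\ c_j+e_{ij}\mapsto\mathsf{nil}\big),$$ where $c_0,c_1,\dots,c_n$ are distinct variables and each edge is written as $(v_i,v_j)$ in some fixed orientation. Then $A_G$ is satisfiable (there exist a stack $s$ and heap $h$ with $s,h\models A_G$) if and only if $G$ has a proper $3$-colouring (an assignment of colours from $\{1,2,3\}$ to the vertices such that adjacent vertices receive distinct colours).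
   Context: Minimal pointer arithmetic: terms $t ::= x \mid t+k$ ($x$ a variable, $k\in\mathbb{N}$); pure formulas $\Pi ::= t=t \mid t\le t \mid t<t \mid \Pi\wedge\Pi$; spatial formulas $F ::= \mathsf{emp}\mid t\mapsto\mathsf{nil}\mid F*F$; a quantifier-free symbolic heap is $\Pi:F$. Values are natural numbers or the non-addressable value $\mathit{nil}$. A stack $s$ maps variables to values, extended by $s(k)=k$, $s(t+k)=s(t)+k$, $s(\mathsf{nil})=\mathit{nil}$. A heap is a finite partial function from $\mathbb{N}$ to values; $h_1\circ h_2$ is the union of domain-disjoint heaps. $s,h\models t_1\sim t_2$ iff $s(t_1)\sim s(t_2)$; $\wedge$ as usual; $s,h\models\mathsf{emp}$ iff $h$ is empty; $s,h\models t\mapsto\mathsf{nil}$ iff $\mathrm{dom}(h)=\{s(t)\}$ and $h(s(t))=\mathit{nil}$; $s,h\models F_1*F_2$ iff $h=h_1\circ h_2$ with $s,h_1\models F_1$ and $s,h_2\models F_2$; $s,h\models\Pi:F$ iff both parts hold. -}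

module Defs where

open import Data.Nat using (ℕ; zero; suc; _+_; _*_; _≤_; _<_)
open import Data.Fin using (Fin; toℕ)
open import Data.List using (List; []; _∷_; map; foldr; allFin)
open import Data.List.Relation.Unary.All using (All)
open import Data.List.Relation.Unary.AllPairs using (AllPairs)
open import Data.Maybe using (Maybe; just; nothing)
open import Data.Product using (_×_; _,_; Σ; ∃; ∃-syntax)
open import Data.Sum using (_⊎_)
open import Relation.Binary.PropositionalEquality using (_≡_; _≢_)
open import Relation.Nullary using (¬_)

Var : Set
Var = ℕ

data Term : Set where
  var  : Var → Term
  _+ₜ_ : Term → ℕ → Term

data Pure : Set where
  _=ₚ_ : Term → Term → Pure
  _≤ₚ_ : Term → Term → Pure
  _<ₚ_ : Term → Term → Pure
  _∧ₚ_ : Pure → Pure → Pure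

data Spatial : Set where
  emp   : Spatial
  _↦nil : Term → Spatial
  _✶_   : Spatial → Spatial → Spatial

record SymbolicHeap : Set where
  constructor _∶_
  field
    pure    : Pure
    spatial : Spatial

data Val : Set where
  num : ℕ → Val
  nil : Val

Stack : Set
Stack = Var → Val

record Heap : Set where
  field
    at     : ℕ → Maybe Val
    finite : ∃[ b ] (∀ x → b ≤ x → at x ≡ nothing)
open Heap public

_+ᵥ_ : Val → ℕ → Val
num m +ᵥ k = num (m + k)
nil   +ᵥ k = nil

eval : Stack → Term → Val
eval s (var x)  = s x
eval s (t +ₜ k) = eval s t +ᵥ k

_≤ᵥ_ : Val → Val → Set
num a ≤ᵥ num b = a ≤ b
_     ≤ᵥ _     = Data.Empty.⊥
  where import Data.Empty

_<ᵥ_ : Val → Val → Set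
num a <ᵥ num b = a < b
_     <ᵥ _     = Data.Empty.⊥
  where import Data.Empty

_⊨ₚ_ : Stack → Pure → Set
s ⊨ₚ (t₁ =ₚ t₂) = eval s t₁ ≡ eval s t₂
s ⊨ₚ (t₁ ≤ₚ t₂) = eval s t₁ ≤ᵥ eval s t₂
s ⊨ₚ (t₁ <ₚ t₂) = eval s t₁ <ᵥ eval s t₂
s ⊨ₚ (π₁ ∧ₚ π₂) = (s ⊨ₚ π₁) × (s ⊨ₚ π₂)

Split : Heap → Heap → Heap → Set
Split h h₁ h₂ = ∀ x →
    (at h x ≡ at h₁ x × at h₂ x ≡ nothing)
  ⊎ (at h x ≡ at h₂ x × at h₁ x ≡ nothing)

_,_⊨ₛ_ : Stack → Heap → Spatial → Set
s , h ⊨ₛ emp      = ∀ x → at h x ≡ nothing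
s , h ⊨ₛ (t ↦nil) = Σ ℕ λ a → eval s t ≡ num a ×
                     (at h a ≡ just nil) × (∀ x → x ≢ a → at h x ≡ nothing)
s , h ⊨ₛ (F₁ ✶ F₂) = Σ Heap λ h₁ → Σ Heap λ h₂ →
                     Split h h₁ h₂ × (s , h₁ ⊨ₛ F₁) × (s , h₂ ⊨ₛ F₂)

_,_⊨_ : Stack → Heap → SymbolicHeap → Set
s , h ⊨ (π ∶ F) = (s ⊨ₚ π) × (s , h ⊨ₛ F)

Satisfiable : SymbolicHeap → Set
Satisfiable A = Σ Stack λ s → Σ Heap λ h → s , h ⊨ A

-- A finite simple undirected graph on vertices v₁..vₙ (represented by
-- Fin n, vertex i : Fin n is v_{toℕ i + 1}), given by the list of its
-- edges, each in a fixed orientation (i , j).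
SameEdge : ∀ {n} → Fin n × Fin n → Fin n × Fin n → Set
SameEdge (i , j) (k , l) = (i ≡ k × j ≡ l) ⊎ (i ≡ l × j ≡ k)

record SimpleGraph (n : ℕ) : Set where
  field
    edges   : List (Fin n × Fin n)
    noLoops : All (λ e → Data.Product.proj₁ e ≢ Data.Product.proj₂ e) edges
    noDup   : AllPairs (λ e e′ → ¬ SameEdge e e′) edges
open SimpleGraph public

-- proper 3-colouring, colours {1,2,3} represented by Fin 3
Proper3Colouring : ∀ {n} → SimpleGraph n → (Fin n → Fin 3) → Set
Proper3Colouring G col =
  All (λ e → col (Data.Product.proj₁ e) ≢ col (Data.Product.proj₂ e)) (edges G)

ThreeColourable : ∀ {n} → SimpleGraph n → Set
ThreeColourable G = ∃[ col ] Proper3Colouring G col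

idx : ∀ {n} → Fin n → ℕ
idx i = suc (toℕ i)

c : ℕ → Term
c k = var k

e : (n i j : ℕ) → ℕ
e n i j = i * (n * n) + j * n

⋀ : List Pure → Pure
⋀ []           = c 0 =ₚ c 0
⋀ (π ∷ [])     = π
⋀ (π ∷ π′ ∷ πs) = π ∧ₚ ⋀ (π′ ∷ πs)

⊛ : List Spatial → Spatial
⊛ = foldr _✶_ emp

pureA : (n : ℕ) → Pure
pureA n = ⋀ (map (λ (i : Fin n) →
  ((c 0 +ₜ 1) ≤ₚ c (idx i)) ∧ₚ (c (idx i) ≤ₚ (c 0 +ₜ 3))) (allFin n))

edgeCells : (n : ℕ) → Fin n × Fin n → Spatial
edgeCells n (i , j) =
  ((c (idx i) +ₜ e n (idx i) (idx j)) ↦nil) ✶ ((c (idx j) +ₜ e n (idx i) (idx j)) ↦nil)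

A : ∀ {n} → SimpleGraph n → SymbolicHeap
A {n} G = pureA n ∶ ⊛ (map (edgeCells n) (edges G))

-- In a model of A_G every cᵢ lies in the window c₀+1 … c₀+3, so cᵢ − c₀ − 1 is a colour, and
-- the two cells cᵢ + e_ij and cⱼ + e_ij of an edge are separated, which forces cᵢ ≠ cⱼ.
-- Conversely, from a colouring take cᵢ = 1 + colour(vᵢ): for n ≥ 3 the address cₓ + e_ij is
-- a base-n numeral whose digits spell out the edge (i , j), so different edges occupy
-- different cells and the heap made of all these cells is a model. A simple graph on fewer
-- than three vertices has at most one edge, so there is nothing to separate.
module Submission where

open import Defs
open import Data.Nat using (ℕ; zero; suc; _+_; _*_; _∸_; _≤_; _<_; z≤n; s≤s; _≟_; _<?_; NonZero; >-nonZero)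
open import Data.Nat.Properties
open import Data.Nat.DivMod using (_%_; [m+kn]%n≡m%n; m<n⇒m%n≡m)
open import Data.Nat.Solver using (module +-*-Solver)
open import Data.Fin using (Fin; toℕ; fromℕ<) renaming (zero to fz; suc to fs)
open import Data.Fin.Properties using (toℕ<n; toℕ-injective; fromℕ<-toℕ; fromℕ<-injective)
open import Data.Bool using (if_then_else_)
open import Data.List using (List; []; _∷_; _++_; [_]; map; concatMap; allFin)
open import Data.List.Extrema.Nat using (max; xs≤max)
open import Data.List.Membership.Propositional using (_∈_; _∉_; find)
open import Data.List.Membership.DecPropositional _≟_ using (_∈?_)
open import Data.List.Membership.Propositional.Properties using (∈-++⁺ˡ; ∈-++⁺ʳ; ∈-++⁻; ∈-concatMap⁻; ∈-allFin)
open import Data.List.Relation.Binary.Disjoint.Propositional using (Disjoint)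
open import Data.List.Relation.Unary.All as All using (All; []; _∷_)
open import Data.List.Relation.Unary.All.Properties using (map⁺; map⁻)
open import Data.List.Relation.Unary.AllPairs using (AllPairs; []; _∷_)
open import Data.List.Relation.Unary.Any using (here; there)
open import Data.Maybe using (Maybe; just; nothing)
open import Data.Product using (_×_; _,_; ∃; proj₁; proj₂)
open import Data.Sum using (inj₁; inj₂; [_,_]′)
open import Data.Empty using (⊥-elim)
open import Function using (_∘_)
open import Function.Bundles using (_⇔_; mk⇔)
open import Relation.Nullary using (¬_; yes; no; does)
open import Relation.Nullary.Decidable using (dec-true; dec-false)
open import Relation.Binary.PropositionalEquality using (_≡_; _≢_; refl; sym; trans; cong; module ≡-Reasoning)

private
  variable
    x : ℕ
    as : List ℕ

cellAt : List ℕ → ℕ → Maybe Val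
cellAt as x = if does (x ∈? as) then just nil else nothing

∉-beyond-max : ∀ as → suc (max 0 as) ≤ x → x ∉ as
∉-beyond-max as max<x x∈as = ≤⇒≯ (All.lookup (xs≤max 0 as) x∈as) max<x

cells-∈ : x ∈ as → cellAt as x ≡ just nil
cells-∈ {x} {as} x∈as rewrite dec-true (x ∈? as) x∈as = refl

cells-∉ : x ∉ as → cellAt as x ≡ nothing
cells-∉ {x} {as} x∉as rewrite dec-false (x ∈? as) x∉as = refl

cells : List ℕ → Heap
cells as = record
  { at     = cellAt as
  ; finite = suc (max 0 as) , λ _ max<x → cells-∉ (∉-beyond-max as max<x)
  }

cells-++-∉ˡ : ∀ as bs → x ∉ as → cellAt (as ++ bs) x ≡ cellAt bs x
cells-++-∉ˡ {x} as bs x∉as with x ∈? bs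
... | yes x∈bs = cells-∈ (∈-++⁺ʳ as x∈bs)
... | no  x∉bs = cells-∉ ([ x∉as , x∉bs ]′ ∘ ∈-++⁻ as)

cells-split : ∀ as bs → Disjoint as bs → Split (cells (as ++ bs)) (cells as) (cells bs)
cells-split as bs disjoint x with x ∈? as
... | yes x∈as = inj₁ (cells-∈ (∈-++⁺ˡ x∈as) , cells-∉ (λ x∈bs → disjoint (x∈as , x∈bs)))
... | no  x∉as = inj₂ (cells-++-∉ˡ as bs x∉as , refl)

cells-↦ : ∀ s t {a} → eval s t ≡ num a → s , cells [ a ] ⊨ₛ (t ↦nil)
cells-↦ _ _ {a} t≡a =
  a , t≡a , cells-∈ {a} {[ a ]} (here refl) , λ x x≢a → cells-∉ {x} {[ a ]} λ { (here x≡a) → x≢a x≡a }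

↦✶↦-distinct : ∀ s {h} t u → s , h ⊨ₛ ((t ↦nil) ✶ (u ↦nil)) → eval s t ≢ eval s u
↦✶↦-distinct _ _ _ (_ , _ , split , (a , t≡a , h₁a , _) , (b , u≡b , h₂b , _)) t≡u
  with refl ← trans (sym t≡a) (trans t≡u u≡b) | split a
... | inj₁ (_ , h₂a≡nothing) with () ← trans (sym h₂b) h₂a≡nothing
... | inj₂ (_ , h₁a≡nothing) with () ← trans (sym h₁a) h₁a≡nothing

⋀⁺ : ∀ {s} πs → All (s ⊨ₚ_) πs → s ⊨ₚ ⋀ πs
⋀⁺ []           _          = refl
⋀⁺ (_ ∷ [])     (p ∷ [])   = p
⋀⁺ (_ ∷ π ∷ πs) (p ∷ ps)   = p , ⋀⁺ (π ∷ πs) ps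

⋀⁻ : ∀ {s} πs → s ⊨ₚ ⋀ πs → All (s ⊨ₚ_) πs
⋀⁻ []           _          = []
⋀⁻ (_ ∷ [])     p          = p ∷ []
⋀⁻ (_ ∷ π ∷ πs) (p , ps)   = p ∷ ⋀⁻ (π ∷ πs) ps

InWindow : Val → Val → Set
InWindow base v = (base +ᵥ 1) ≤ᵥ v × v ≤ᵥ (base +ᵥ 3)

vertexBounds : ∀ {n} → Fin n → Pure
vertexBounds i = ((c 0 +ₜ 1) ≤ₚ c (idx i)) ∧ₚ (c (idx i) ≤ₚ (c 0 +ₜ 3))

⊨-pureA⁺ : ∀ {n s} → (∀ (i : Fin n) → InWindow (s 0) (s (idx i))) → s ⊨ₚ pureA n
⊨-pureA⁺ {n} window = ⋀⁺ (map vertexBounds (allFin n)) (map⁺ (All.tabulate λ {i} _ → window i))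

⊨-pureA⁻ : ∀ {n s} → s ⊨ₚ pureA n → (i : Fin n) → InWindow (s 0) (s (idx i))
⊨-pureA⁻ {n} ⊨π i = All.lookup (map⁻ (⋀⁻ (map vertexBounds (allFin n)) ⊨π)) (∈-allFin i)

windowIndex : ∀ base v → InWindow base v → Fin 3
windowIndex (num z) (num v) (_ , v≤z+3) = fromℕ< (s≤s (begin
  v ∸ (z + 1)         ≤⟨ ∸-monoˡ-≤ (z + 1) v≤z+3 ⟩
  (z + 3) ∸ (z + 1)   ≡⟨ [m+n]∸[m+o]≡n∸o z 3 1 ⟩
  2                   ∎))
  where open ≤-Reasoning
windowIndex (num _) nil (() , _)
windowIndex nil     _   (() , _)

windowIndex-injective : ∀ base v v′ (w : InWindow base v) (w′ : InWindow base v′) →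
  windowIndex base v w ≡ windowIndex base v′ w′ → v ≡ v′
windowIndex-injective (num z) (num v) (num v′) (lo , _) (lo′ , _) eq =
  cong num (∸-cancelʳ-≡ lo lo′ (fromℕ<-injective _ _ _ _ eq))
windowIndex-injective (num _) (num _) nil _  (() , _) _
windowIndex-injective (num _) nil     _   (() , _) _ _
windowIndex-injective nil     _       _   (() , _) _ _

remainder-quotient-unique : ∀ {m r r′} q q′ → r < m → r′ < m →
  r + q * m ≡ r′ + q′ * m → r ≡ r′ × q ≡ q′
remainder-quotient-unique {m} {r} {r′} q q′ r<m r′<m eq = r≡r′ , q≡q′
  where
  instance
    m≢0 : NonZero m
    m≢0 = >-nonZero (≤-<-trans z≤n r<m)
  open ≡-Reasoning
  r≡r′ : r ≡ r′
  r≡r′ = begin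
    r                  ≡⟨ m<n⇒m%n≡m r<m ⟨
    r % m              ≡⟨ [m+kn]%n≡m%n r q m ⟨
    (r + q * m) % m    ≡⟨ cong (_% m) eq ⟩
    (r′ + q′ * m) % m  ≡⟨ [m+kn]%n≡m%n r′ q′ m ⟩
    r′ % m             ≡⟨ m<n⇒m%n≡m r′<m ⟩
    r′                 ∎
  q≡q′ : q ≡ q′
  q≡q′ = *-cancelʳ-≡ q q′ m (+-cancelˡ-≡ r _ _ (trans eq (cong (_+ q′ * m) (sym r≡r′))))

-- Lowering every digit by one turns an address into a base-n numeral with digits a, j, i.
address-as-numeral : ∀ n a i j →
  suc a + e n (suc i) (suc j) ≡ suc (n * n + n) + ((a + j * n) + i * (n * n))
address-as-numeral = solve 4 (λ n a i j →
    (con 1 :+ a) :+ ((con 1 :+ i) :* (n :* n) :+ (con 1 :+ j) :* n)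
  := (con 1 :+ (n :* n :+ n)) :+ ((a :+ j :* n) :+ i :* (n :* n))) refl
  where open +-*-Solver

two-digits<square : ∀ {n a j} → a < n → j < n → a + j * n < n * n
two-digits<square {n} {j = j} a<n j<n = ≤-trans (+-monoˡ-< (j * n) a<n) (*-monoˡ-≤ n j<n)

address-injective : ∀ {n a b i j k l} → a < n → b < n → j < n → l < n →
  suc a + e n (suc i) (suc j) ≡ suc b + e n (suc k) (suc l) → i ≡ k × j ≡ l
address-injective {n} {a} {b} {i} {j} {k} {l} a<n b<n j<n l<n eq =
  let low≡ , i≡k = remainder-quotient-unique i k (two-digits<square a<n j<n) (two-digits<square b<n l<n)
                     (+-cancelˡ-≡ (suc (n * n + n)) _ _
                       (trans (sym (address-as-numeral n a i j)) (trans eq (address-as-numeral n b k l))))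
      _ , j≡l    = remainder-quotient-unique j l a<n b<n low≡
  in i≡k , j≡l

loopless-edges-coincide-<3 : ∀ {n} → n < 3 → (i j k l : Fin n) → i ≢ j → k ≢ l → SameEdge (i , j) (k , l)
loopless-edges-coincide-<3 {suc (suc (suc _))} (s≤s (s≤s (s≤s ()))) _ _ _ _ _ _
loopless-edges-coincide-<3 _ fz      fz      _       _       i≢j _   = ⊥-elim (i≢j refl)
loopless-edges-coincide-<3 _ (fs fz) (fs fz) _       _       i≢j _   = ⊥-elim (i≢j refl)
loopless-edges-coincide-<3 _ _       _       fz      fz      _   k≢l = ⊥-elim (k≢l refl)
loopless-edges-coincide-<3 _ _       _       (fs fz) (fs fz) _   k≢l = ⊥-elim (k≢l refl)
loopless-edges-coincide-<3 _ fz      (fs fz) fz      (fs fz) _   _   = inj₁ (refl , refl)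
loopless-edges-coincide-<3 _ fz      (fs fz) (fs fz) fz      _   _   = inj₂ (refl , refl)
loopless-edges-coincide-<3 _ (fs fz) fz      fz      (fs fz) _   _   = inj₂ (refl , refl)
loopless-edges-coincide-<3 _ (fs fz) fz      (fs fz) fz      _   _   = inj₁ (refl , refl)

cellAddress : (n : ℕ) → Fin 3 → Fin n × Fin n → ℕ
cellAddress n a (i , j) = suc (toℕ a) + e n (idx i) (idx j)

cellAddress-determines-edge : ∀ {n} a b (i j k l : Fin n) → i ≢ j → k ≢ l →
  cellAddress n a (i , j) ≡ cellAddress n b (k , l) → SameEdge (i , j) (k , l)
cellAddress-determines-edge {n} a b i j k l i≢j k≢l eq with n <? 3
... | yes n<3 = loopless-edges-coincide-<3 n<3 i j k l i≢j k≢l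
... | no  n≮3 =
  let 3≤n = ≮⇒≥ n≮3
      i≡k , j≡l = address-injective (≤-trans (toℕ<n a) 3≤n) (≤-trans (toℕ<n b) 3≤n)
                    (toℕ<n j) (toℕ<n l) eq
  in inj₁ (toℕ-injective i≡k , toℕ-injective j≡l)

module _ {n : ℕ} (col : Fin n → Fin 3) where

  colouringStack : Stack
  colouringStack zero = num 0
  colouringStack (suc k) with k <? n
  ... | yes k<n = num (suc (toℕ (col (fromℕ< k<n))))
  ... | no  _   = nil

  colouringStack-idx : ∀ i → colouringStack (idx i) ≡ num (suc (toℕ (col i)))
  colouringStack-idx i with toℕ i <? n
  ... | yes i<n = cong (λ v → num (suc (toℕ (col v)))) (fromℕ<-toℕ i i<n)
  ... | no  i≮n = ⊥-elim (i≮n (toℕ<n i))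

  colouringStack-⊨-pureA : colouringStack ⊨ₚ pureA n
  colouringStack-⊨-pureA = ⊨-pureA⁺ window
    where
    window : ∀ i → InWindow (num 0) (colouringStack (idx i))
    window i rewrite colouringStack-idx i = s≤s z≤n , toℕ<n (col i)

  edgeAddresses : Fin n × Fin n → List ℕ
  edgeAddresses (i , j) = cellAddress n (col i) (i , j) ∷ cellAddress n (col j) (i , j) ∷ []

  ∈-edgeAddresses : ∀ {v ed} → v ∈ edgeAddresses ed → ∃ λ a → v ≡ cellAddress n a ed
  ∈-edgeAddresses {ed = i , _} (here v≡)         = col i , v≡
  ∈-edgeAddresses {ed = _ , j} (there (here v≡)) = col j , v≡

  edgeAddresses-disjoint : ∀ {i j} L → i ≢ j → All (λ ed → proj₁ ed ≢ proj₂ ed) L →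
    All (λ ed → ¬ SameEdge (i , j) ed) L → Disjoint (edgeAddresses (i , j)) (concatMap edgeAddresses L)
  edgeAddresses-disjoint {i} {j} L i≢j loopless distinct (v∈ij , v∈L) =
    let (k , l) , kl∈L , v∈kl = find (∈-concatMap⁻ edgeAddresses {xs = L} v∈L)
        a , v≡a = ∈-edgeAddresses v∈ij
        b , v≡b = ∈-edgeAddresses v∈kl
    in All.lookup distinct kl∈L
         (cellAddress-determines-edge a b i j k l i≢j (All.lookup loopless kl∈L) (trans (sym v≡a) v≡b))

  edgeAddresses-⊨-edgeCells : ∀ {i j} → col i ≢ col j →
    colouringStack , cells (edgeAddresses (i , j)) ⊨ₛ edgeCells n (i , j)
  edgeAddresses-⊨-edgeCells {i} {j} colours≢ =
    cells [ address i ] , cells [ address j ] ,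
    cells-split [ address i ] [ address j ] (λ { (here refl , here eq) → colours≢ (address≡⇒col≡ eq) }) ,
    cells-↦ colouringStack (cell i) (evalAddress i) ,
    cells-↦ colouringStack (cell j) (evalAddress j)
    where
    address : Fin n → ℕ
    address x = cellAddress n (col x) (i , j)
    cell : Fin n → Term
    cell x = c (idx x) +ₜ e n (idx i) (idx j)
    evalAddress : ∀ x → eval colouringStack (cell x) ≡ num (address x)
    evalAddress x = cong (_+ᵥ e n (idx i) (idx j)) (colouringStack-idx x)
    address≡⇒col≡ : address i ≡ address j → col i ≡ col j
    address≡⇒col≡ = toℕ-injective ∘ suc-injective ∘ +-cancelʳ-≡ (e n (idx i) (idx j)) _ _

  colouringStack-⊨-edges : ∀ L → All (λ ed → proj₁ ed ≢ proj₂ ed) L →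
    AllPairs (λ ed ed′ → ¬ SameEdge ed ed′) L → All (λ ed → col (proj₁ ed) ≢ col (proj₂ ed)) L →
    colouringStack , cells (concatMap edgeAddresses L) ⊨ₛ ⊛ (map (edgeCells n) L)
  colouringStack-⊨-edges []       _ _ _ = λ _ → refl
  colouringStack-⊨-edges (ed ∷ L) (noLoop ∷ loopless) (distinct ∷ noDup) (proper ∷ propers) =
    cells (edgeAddresses ed) , cells (concatMap edgeAddresses L) ,
    cells-split (edgeAddresses ed) _ (edgeAddresses-disjoint L noLoop loopless distinct) ,
    edgeAddresses-⊨-edgeCells proper ,
    colouringStack-⊨-edges L loopless noDup propers

edges-separated : ∀ {n s h} L → s , h ⊨ₛ ⊛ (map (edgeCells n) L) →
  All (λ ed → s (idx (proj₁ ed)) ≢ s (idx (proj₂ ed))) L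
edges-separated []            _ = []
edges-separated {n} {s} ((i , j) ∷ L) (h₁ , _ , _ , ⊨edge , ⊨rest) =
  (↦✶↦-distinct s {h₁} (c (idx i) +ₜ eᵢⱼ) (c (idx j) +ₜ eᵢⱼ) ⊨edge ∘ cong (_+ᵥ eᵢⱼ)) ∷
  edges-separated L ⊨rest
  where eᵢⱼ = e n (idx i) (idx j)

soundness : ∀ {n} (G : SimpleGraph n) → Satisfiable (A G) → ThreeColourable G
soundness {n} G (s , h , ⊨π , ⊨F) =
  colour , All.map (λ separated → separated ∘ windowIndex-injective (s 0) _ _ (window _) (window _))
                   (edges-separated (edges G) ⊨F)
  where
  window : ∀ i → InWindow (s 0) (s (idx i))
  window = ⊨-pureA⁻ ⊨π
  colour : Fin n → Fin 3
  colour i = windowIndex (s 0) (s (idx i)) (window i)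

completeness : ∀ {n} (G : SimpleGraph n) → ThreeColourable G → Satisfiable (A G)
completeness G (col , proper) =
  colouringStack col , cells (concatMap (edgeAddresses col) (edges G)) ,
  colouringStack-⊨-pureA col , colouringStack-⊨-edges col (edges G) (noLoops G) (noDup G) proper

lemma2 : (n : ℕ) (G : SimpleGraph n) → Satisfiable (A G) ⇔ ThreeColourable G
lemma2 n G = mk⇔ (soundness G) (completeness G)
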